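{- Let $w\ge2$ be even. Define $\beta_w:\mathcal E_w\to\mathcal U_w$ by $\beta_w(E)(h,k)=E(h,k)-E(k,-h)$ for positive integers $h,k$. Then $\beta_w$ is an epimorphism with $\beta_w(\mathcal E_w^{\pm})=\mathcal U_w^{\pm}$, and $\ker\beta_w$ is the one-dimensional subspace of $\mathcal E_w$ spanned by $G_w$. In particular the restriction $\beta_w^-:\mathcal E_w^-\to\mathcal U_w^-$ is an isomorphism, and the restriction $\beta_w^+:\mathcal E_w^+\to\mathcal U_w^+$ is an epimorphism whose kernel is the one-dimensional subspace of $\mathcal E_w^+$ spanned by $G_w$.
   Context: A weighted Dedekind symbol of weight $w$ is a function $E:\mathbb Z^+\times\mathbb Z\to\mathbb C$ with $E(h,k)=E(h,k+h)$ for all $(h,k)$ and $E(ch,ck)=c^wE(h,k)$ for all $(h,k)$ and $c\in\mathbb Z^+$; it is even (resp. odd) if $E(h,-k)=E(h,k)$ (resp. $=-E(h,k)$). $\mathcal E_w$ is the space of weighted Dedekind symbols $E$ of weight $w$ such that $E(h,k)-E(k,-h)$ is a homogeneous polynomial in $h,k$ of degree $w$; $\mathcal E_w^\pm$ are its even/odd subspaces. $\mathcal U_w$ is the space of homogeneous polynomials $g$ in $h,k$ of degree $w$ with $g(h+k,k)+g(h,h+k)=g(h,k)$ and $g(1,1)=0$; $\mathcal U_w^+$ (resp. $\mathcal U_w^-$) consists of those with $g(h,-k)=g(h,k)$ (resp. $g(h,-k)=-g(h,k)$). $G_w(h,k)=\gcd(h,k)^w$. -}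

module Defs where

open import Level using (Level; _⊔_) renaming (suc to lsuc)
open import Algebra.Bundles using (CommutativeRing; Semiring)
import Algebra.Definitions.RawSemiring as RawSemiringDefs
open import Data.Nat as ℕ using (ℕ; zero; suc)
open import Data.Nat.GCD using (gcd)
open import Data.Integer as ℤ using (ℤ; +_; -[1+_]; ∣_∣)
open import Data.Fin using (Fin; toℕ)
open import Data.Product using (Σ; ∃; _×_)
open import Relation.Nullary using (¬_)

record Field (c ℓ : Level) : Set (lsuc (c ⊔ ℓ)) where
  field
    commutativeRing : CommutativeRing c ℓ
  open CommutativeRing commutativeRing public
  field
    1≉0     : ¬ (1# ≈ 0#)
    inverse : ∀ x → ¬ (x ≈ 0#) → Σ Carrier λ y → x * y ≈ 1#

module Theory {c ℓ : Level} (K : Field c ℓ) where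
  open Field K renaming (Carrier to A)
  open RawSemiringDefs (Semiring.rawSemiring semiring) using (_^_) renaming (_×_ to _·ℕ_)

  CharZero : Set ℓ
  CharZero = ∀ n → ¬ ((suc n ·ℕ 1#) ≈ 0#)

  ι : ℤ → A
  ι (+ n)      = n ·ℕ 1#
  ι -[1+ n ]   = - (suc n ·ℕ 1#)

  ∑ : (n : ℕ) → (Fin n → A) → A
  ∑ zero    f = 0#
  ∑ (suc n) f = f Fin.zero + ∑ n (λ j → f (Fin.suc j))
    where import Data.Fin as Fin

  evalHom : (w : ℕ) → (Fin (suc w) → A) → ℤ → ℤ → A
  evalHom w cf h k = ∑ (suc w) (λ j → cf j * (ι h ^ toℕ j) * (ι k ^ (w ℕ.∸ toℕ j)))

  IsHomPoly : ℕ → (ℤ → ℤ → A) → Set (c ⊔ ℓ)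
  IsHomPoly w g = Σ (Fin (suc w) → A) λ cf → ∀ h k → g h k ≈ evalHom w cf h k

  -- Functions ℤ⁺ × ℤ → K are represented as ℕ → ℤ → K; only the values
  -- at positive first argument are ever used (see EqSym).
  Sym : Set c
  Sym = ℕ → ℤ → A

  IsWDS : ℕ → Sym → Set ℓ
  IsWDS w E =
    (∀ h k → 0 ℕ.< h → E h (k ℤ.+ + h) ≈ E h k) ×
    (∀ (m h : ℕ) (k : ℤ) → 0 ℕ.< m → 0 ℕ.< h →
       E (m ℕ.* h) (+ m ℤ.* k) ≈ (ι (+ m) ^ w) * E h k)

  β : Sym → ℕ → ℕ → A
  β E h k = E h (+ k) - E k (ℤ.- (+ h))

  Represents : Sym → (ℤ → ℤ → A) → Set ℓ
  Represents E g = ∀ h k → 0 ℕ.< h → 0 ℕ.< k → β E h k ≈ g (+ h) (+ k)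

  InE : ℕ → Sym → Set (c ⊔ ℓ)
  InE w E = IsWDS w E × Σ (ℤ → ℤ → A) λ g → IsHomPoly w g × Represents E g

  EvenE OddE : Sym → Set ℓ
  EvenE E = ∀ h k → 0 ℕ.< h → E h (ℤ.- k) ≈ E h k
  OddE  E = ∀ h k → 0 ℕ.< h → E h (ℤ.- k) ≈ - E h k

  InU : ℕ → (ℤ → ℤ → A) → Set (c ⊔ ℓ)
  InU w g = IsHomPoly w g ×
            (∀ h k → g (h ℤ.+ k) k + g h (h ℤ.+ k) ≈ g h k) ×
            g (+ 1) (+ 1) ≈ 0#

  EvenU OddU : (ℤ → ℤ → A) → Set ℓ
  EvenU g = ∀ h k → g h (ℤ.- k) ≈ g h k
  OddU  g = ∀ h k → g h (ℤ.- k) ≈ - g h k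

  G : ℕ → Sym
  G w h k = ι (+ gcd h ∣ k ∣) ^ w

  0P : ℤ → ℤ → A
  0P _ _ = 0#

  _•_ : A → Sym → Sym
  (a • E) h k = a * E h k

  EqSym : Sym → Sym → Set ℓ
  EqSym E E' = ∀ h k → 0 ℕ.< h → E h k ≈ E' h k

{-# OPTIONS --safe #-}

-- For a periodic symbol E, β(E) satisfies the
-- three-term relation of 𝓤_w on ℤ⁺ × ℤ⁺, and a polynomial satisfying it there satisfies
-- it on ℤ × ℤ. Conversely, periodicity and E(h,k) = β(E)(h,k) + E(k,−h) run the
-- Euclidean algorithm on (h,k), so a periodic symbol is determined by β(E) together
-- with its values E(d,0) = d^w E(1,0). This yields the kernel (G_w is periodic with
-- β(G_w) = 0), injectivity on odd symbols (where E(d,0) = 0) and, read as a recursive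
-- definition, a preimage of every g ∈ 𝓤_w. For even w every g ∈ 𝓤_w satisfies
-- g(h,−k) = −g(k,h); hence β preserves parity, and the even and odd parts
-- ½(E(h,k) ± E(h,−k)) of a preimage of an even, resp. odd, g are again preimages of g.

module Submission where

open import Defs
open import Level using (Level)
open import Function using (_∘_)
open import Data.List using (_∷_; [])
open import Data.Nat.Induction using (<-rec)
open import Data.Fin as Fin using (Fin; toℕ)
open import Data.Fin.Properties using (toℕ≤pred[n])
open import Data.Nat as ℕ using (ℕ; zero; suc; s≤s; z≤n; NonZero)
import Data.Nat.Properties as ℕP
open import Data.Nat.DivMod using (_%_; _/_; m%n<n; m<n⇒m%n≡m; [m+n]%n≡m%n; m≤n⇒[n∸m]%m≡n%m; m≡m%n+[m/n]*n)
open import Data.Nat.GCD using (gcd; gcd-greatest; gcd-universality; gcd[m,n]∣m; gcd[m,n]∣n; gcd-comm; gcd-identityʳ; c*gcd[m,n]≡gcd[cm,cn])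
open import Data.Nat.Divisibility using (_∣_; ∣-trans)
open import Data.Integer as ℤ using (ℤ; +_; -[1+_]; _⊖_; ∣_∣; 0ℤ; 1ℤ; -1ℤ)
import Data.Integer.Properties as ℤP
open import Data.Integer.Divisibility.Signed using () renaming (_∣_ to _ℤ∣_)
open import Data.Integer.Divisibility.Signed using (∣ᵤ⇒∣; ∣⇒∣ᵤ; ∣m∣n⇒∣m+n; ∣m+n∣n⇒∣m)
open import Data.Integer.Tactic.RingSolver as ℤSolver using ()
open import Data.Product using (Σ; _×_; _,_; proj₁; proj₂)
open import Data.Sum using (inj₁; inj₂)
open import Data.Sign.Base as Sign using (Sign)
open import Data.Maybe using (just; nothing)
open import Relation.Nullary using (yes; no)
open import Relation.Binary.Definitions using (WeaklyDecidable; tri<; tri≈; tri>)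
open import Relation.Binary.PropositionalEquality as ≡ using (_≡_)
open import Algebra.Bundles using (CommutativeRing; Semiring)
import Algebra.Definitions.RawSemiring as RawSemiringDefs
open import Algebra.Solver.Ring.AlmostCommutativeRing using (_-Raw-AlmostCommutative⟶_; Induced-equivalence; fromCommutativeRing)

-- The residue of k modulo h in [0, h). It equals Data.Integer's k %ℕ h, but is
-- defined without a with-clause, which makes its periodicity easy to prove.
infixl 7 _%ℤ_
_%ℤ_ : ℤ → (h : ℕ) .{{_ : NonZero h}} → ℕ
+ n      %ℤ h = n % h
-[1+ n ] %ℤ h = h ℕ.∸ suc (n % h)

%ℤ-< : ∀ k h .{{_ : NonZero h}} → k %ℤ h ℕ.< h
%ℤ-< (+ n)    h        = m%n<n n h
%ℤ-< -[1+ n ] (suc h′) = s≤s (ℕP.m∸n≤m h′ (n % suc h′))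

%ℤ-periodic : ∀ k h .{{_ : NonZero h}} → (k ℤ.+ + h) %ℤ h ≡ k %ℤ h
%ℤ-periodic (+ n)    h        = [m+n]%n≡m%n n h
%ℤ-periodic -[1+ n ] h@(suc h′) with ℕP.<-≤-connex n h
... | inj₁ n<h = begin
  (h ⊖ suc n) %ℤ h   ≡⟨ ≡.cong (_%ℤ h) (ℤP.⊖-≥ n<h) ⟩
  (h ℕ.∸ suc n) % h  ≡⟨ m<n⇒m%n≡m (s≤s (ℕP.m∸n≤m h′ n)) ⟩
  h ℕ.∸ suc n        ≡⟨ ≡.cong (λ r → h ℕ.∸ suc r) (m<n⇒m%n≡m n<h) ⟨
  h ℕ.∸ suc (n % h)  ∎
  where open ≡.≡-Reasoning
... | inj₂ h≤n = begin
  (h ⊖ suc n) %ℤ h                ≡⟨ ≡.cong (_%ℤ h) (ℤP.⊖-< (s≤s h≤n)) ⟩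
  (ℤ.- + (suc n ℕ.∸ h)) %ℤ h      ≡⟨ ≡.cong (λ r → (ℤ.- + r) %ℤ h) (ℕP.+-∸-assoc 1 h≤n) ⟩
  h ℕ.∸ suc ((n ℕ.∸ h) % h)       ≡⟨ ≡.cong (λ r → h ℕ.∸ suc r) (m≤n⇒[n∸m]%m≡n%m h≤n) ⟩
  h ℕ.∸ suc (n % h)               ∎
  where open ≡.≡-Reasoning

-[1+n]+[1+n/h]*h≡+[-[1+n]%ℤh] : ∀ n h .{{_ : NonZero h}} → -[1+ n ] ℤ.+ + (suc (n / h) ℕ.* h) ≡ + (-[1+ n ] %ℤ h)
-[1+n]+[1+n/h]*h≡+[-[1+n]%ℤh] n h = begin
  (h ℕ.+ q ℕ.* h) ⊖ suc n            ≡⟨ ≡.cong₂ _⊖_ (ℕP.+-comm h (q ℕ.* h)) 1+n≡qh+[1+r] ⟩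
  (q ℕ.* h ℕ.+ h) ⊖ (q ℕ.* h ℕ.+ suc r) ≡⟨ ℤP.+-cancelˡ-⊖ (q ℕ.* h) h (suc r) ⟩
  h ⊖ suc r                          ≡⟨ ℤP.⊖-≥ (m%n<n n h) ⟩
  + (h ℕ.∸ suc r)                    ∎
  where
  open ≡.≡-Reasoning
  q = n / h
  r = n % h
  1+n≡qh+[1+r] : suc n ≡ q ℕ.* h ℕ.+ suc r
  1+n≡qh+[1+r] = ≡.trans (≡.cong suc (≡.trans (m≡m%n+[m/n]*n n h) (ℕP.+-comm r (q ℕ.* h)))) (≡.sym (ℕP.+-suc (q ℕ.* h) r))

x+[a+b]≡[x+b]+a : ∀ x a b → x ℤ.+ (a ℤ.+ b) ≡ (x ℤ.+ b) ℤ.+ a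
x+[a+b]≡[x+b]+a = ℤSolver.solve-∀

-[h+k]+k≡-h : ∀ h k → ℤ.- (h ℤ.+ k) ℤ.+ k ≡ ℤ.- h
-[h+k]+k≡-h = ℤSolver.solve-∀

[x+c]+1≡[x+1]+c : ∀ x c → (x ℤ.+ c) ℤ.+ 1ℤ ≡ (x ℤ.+ 1ℤ) ℤ.+ c
[x+c]+1≡[x+1]+c = ℤSolver.solve-∀

x+[1+n]≡[x+n]+1 : ∀ x n → x ℤ.+ + suc n ≡ (x ℤ.+ + n) ℤ.+ 1ℤ
x+[1+n]≡[x+n]+1 x n = ≡.trans (≡.cong (λ m → x ℤ.+ + m) (ℕP.+-comm 1 n)) (≡.sym (ℤP.+-assoc x (+ n) 1ℤ))

Affine : (ℤ → ℤ) → Set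
Affine a = Σ ℤ λ a₁ → Σ ℤ λ a₀ → ∀ t → a t ≡ a₁ ℤ.* t ℤ.+ a₀

Affine₂ : (ℤ → ℤ → ℤ) → Set
Affine₂ a = (∀ y → Affine (λ x → a x y)) × (∀ x → Affine (a x))

affine-x : Affine₂ (λ x y → x)
affine-x = (λ _ → 1ℤ , 0ℤ , λ t → ℤSolver.solve (t ∷ [])) , (λ x → 0ℤ , x , λ t → ℤSolver.solve (t ∷ x ∷ []))

affine-y : Affine₂ (λ x y → y)
affine-y = (λ y → 0ℤ , y , λ t → ℤSolver.solve (t ∷ y ∷ [])) , (λ _ → 1ℤ , 0ℤ , λ t → ℤSolver.solve (t ∷ []))

affine-x+y : Affine₂ (λ x y → x ℤ.+ y)
affine-x+y = (λ y → 1ℤ , y , λ t → ℤSolver.solve (t ∷ y ∷ [])) , (λ x → 1ℤ , x , λ t → ℤSolver.solve (t ∷ x ∷ []))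

affine--y : Affine₂ (λ x y → ℤ.- y)
affine--y = (λ y → 0ℤ , ℤ.- y , λ t → ℤSolver.solve (t ∷ y ∷ [])) , (λ _ → ℤ.- 1ℤ , 0ℤ , λ t → ℤSolver.solve (t ∷ []))

[h+k]-k≡h : ∀ h k → (h ℤ.+ k) ℤ.+ ℤ.- k ≡ h
[h+k]-k≡h = ℤSolver.solve-∀

-h+[h+k]≡k : ∀ h k → ℤ.- h ℤ.+ (h ℤ.+ k) ≡ k
-h+[h+k]≡k = ℤSolver.solve-∀

2^n≡2+N : ∀ {n} → 0 ℕ.< n → Σ ℕ λ N → 2 ℕ.^ n ≡ 2 ℕ.+ N
2^n≡2+N {suc n} _ with N , 2+N≡2^n ← ℕP.m≤n⇒∃[o]m+o≡n (ℕP.*-monoʳ-≤ 2 (ℕP.m^n>0 2 n)) = N , ≡.sym 2+N≡2^n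

gcd[n,∣k+n∣]≡gcd[n,∣k∣] : ∀ n k → gcd n ∣ k ℤ.+ + n ∣ ≡ gcd n ∣ k ∣
gcd[n,∣k+n∣]≡gcd[n,∣k∣] n k = ≡.sym (gcd-universality common⇒ ⇒common)
  where
  signed : ∀ {d} i → d ∣ (∣ i ∣) → + d ℤ∣ i
  signed i = ∣ᵤ⇒∣ {k = + _} {i}
  common⇒ : ∀ {d} → (d ∣ n) × (d ∣ (∣ k ℤ.+ + n ∣)) → d ∣ (gcd n ∣ k ∣)
  common⇒ (d∣n , d∣k+n) = gcd-greatest d∣n (∣⇒∣ᵤ (∣m+n∣n⇒∣m {m = k} (signed (k ℤ.+ + n) d∣k+n) (signed (+ n) d∣n)))
  ⇒common : ∀ {d} → d ∣ (gcd n ∣ k ∣) → (d ∣ n) × (d ∣ (∣ k ℤ.+ + n ∣))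
  ⇒common d∣g = d∣n , ∣⇒∣ᵤ (∣m∣n⇒∣m+n (signed k (∣-trans d∣g (gcd[m,n]∣n n ∣ k ∣))) (signed (+ n) d∣n))
    where d∣n = ∣-trans d∣g (gcd[m,n]∣m n ∣ k ∣)

module _ {c ℓ : Level} (K : Field c ℓ) where

  open Field K renaming (Carrier to A; zero to *-zero)
  open Theory K
  open RawSemiringDefs (Semiring.rawSemiring semiring) using (_^_) renaming (_×_ to _·ℕ_)
  open import Relation.Binary.Reasoning.Setoid setoid
  open import Algebra.Properties.Ring ring using (-‿+-comm; x[y-z]≈xy-xz; x∙y⁻¹≈ε⇒x≈y; +-inverseˡ-unique; x≈y⇒x∙y⁻¹≈ε; +-identityʳ-unique; -0#≈0#; -‿involutive; -‿distribˡ-*; -‿distribʳ-*; -1*x≈-x)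
  open import Algebra.Properties.CommutativeSemigroup +-commutativeSemigroup using (interchange)
  open import Algebra.Properties.Semiring.Mult semiring using (×-homo-+; ×1-homo-*; ×-assoc-*; ×-congʳ)
  open import Algebra.Properties.Semiring.Exp semiring using (^-congˡ; ^-homo-*)
  open import Algebra.Properties.CommutativeSemiring.Exp commutativeSemiring using (^-distrib-*)

  [a+x]-[a+y] : ∀ a x y → (a + x) - (a + y) ≈ x - y
  [a+x]-[a+y] a x y = begin
    (a + x) + - (a + y)       ≈⟨ +-congˡ (-‿+-comm a y) ⟨
    (a + x) + (- a + - y)     ≈⟨ interchange a x (- a) (- y) ⟩
    (a + - a) + (x + - y)     ≈⟨ +-congʳ (-‿inverseʳ a) ⟩
    0# + (x + - y)            ≈⟨ +-identityˡ _ ⟩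
    x + - y                   ∎

  ι-⊖ : ∀ m n → ι (m ⊖ n) ≈ ι (+ m) - ι (+ n)
  ι-⊖ zero    zero    = sym (trans (+-congˡ -0#≈0#) (+-identityʳ 0#))
  ι-⊖ (suc m) zero    = sym (trans (+-congˡ -0#≈0#) (+-identityʳ _))
  ι-⊖ zero    (suc n) = sym (+-identityˡ _)
  ι-⊖ (suc m) (suc n) = begin
    ι (suc m ⊖ suc n)          ≡⟨ ≡.cong ι (ℤP.[1+m]⊖[1+n]≡m⊖n m n) ⟩
    ι (m ⊖ n)                  ≈⟨ ι-⊖ m n ⟩
    ι (+ m) - ι (+ n)          ≈⟨ [a+x]-[a+y] 1# _ _ ⟨
    ι (+ suc m) - ι (+ suc n)  ∎

  ι-neg : ∀ x → ι (ℤ.- x) ≈ - ι x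
  ι-neg (+ zero)  = sym -0#≈0#
  ι-neg (+ suc n) = refl
  ι-neg -[1+ n ]  = sym (-‿involutive _)

  ι-+ : ∀ x y → ι (x ℤ.+ y) ≈ ι x + ι y
  ι-+ (+ m)    (+ n)    = ×-homo-+ 1# m n
  ι-+ (+ m)    -[1+ n ] = ι-⊖ m (suc n)
  ι-+ -[1+ m ] (+ n)    = trans (ι-⊖ n (suc m)) (+-comm _ _)
  ι-+ -[1+ m ] -[1+ n ] = begin
    - ι (+ suc (suc (m ℕ.+ n)))       ≡⟨ ≡.cong (λ k → - ι (+ k)) (ℕP.+-suc (suc m) n) ⟨
    - ι (+ (suc m ℕ.+ suc n))         ≈⟨ -‿cong (×-homo-+ 1# (suc m) (suc n)) ⟩
    - (ι (+ suc m) + ι (+ suc n))     ≈⟨ -‿+-comm _ _ ⟨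
    - ι (+ suc m) - ι (+ suc n)       ∎

  ι-+* : ∀ m y → ι (+ m ℤ.* y) ≈ ι (+ m) * ι y
  ι-+* m (+ n)    = trans (reflexive (≡.cong ι (≡.sym (ℤP.pos-* m n)))) (×1-homo-* m n)
  ι-+* m -[1+ n ] = begin
    ι (+ m ℤ.* ℤ.- + suc n)    ≡⟨ ≡.cong ι (ℤP.neg-distribʳ-* (+ m) (+ suc n)) ⟨
    ι (ℤ.- (+ m ℤ.* + suc n))  ≈⟨ ι-neg (+ m ℤ.* + suc n) ⟩
    - ι (+ m ℤ.* + suc n)      ≈⟨ -‿cong (ι-+* m (+ suc n)) ⟩
    - (ι (+ m) * ι (+ suc n))  ≈⟨ -‿distribʳ-* _ _ ⟩
    ι (+ m) * - ι (+ suc n)    ∎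

  ι-* : ∀ x y → ι (x ℤ.* y) ≈ ι x * ι y
  ι-* (+ m)    y = ι-+* m y
  ι-* -[1+ m ] y = begin
    ι (ℤ.- + suc m ℤ.* y)      ≡⟨ ≡.cong ι (ℤP.neg-distribˡ-* (+ suc m) y) ⟨
    ι (ℤ.- (+ suc m ℤ.* y))    ≈⟨ ι-neg (+ suc m ℤ.* y) ⟩
    - ι (+ suc m ℤ.* y)        ≈⟨ -‿cong (ι-+* (suc m) y) ⟩
    - (ι (+ suc m) * ι y)      ≈⟨ -‿distribˡ-* _ _ ⟩
    - ι (+ suc m) * ι y        ∎

  ι-morphism : CommutativeRing.rawRing ℤP.+-*-commutativeRing -Raw-AlmostCommutative⟶ fromCommutativeRing commutativeRing
  ι-morphism = record
    { ⟦_⟧ = ι ; +-homo = ι-+ ; *-homo = ι-* ; -‿homo = ι-neg ; 0-homo = refl ; 1-homo = +-identityʳ 1# }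

  private
    ι-≟ : WeaklyDecidable (Induced-equivalence ι-morphism)
    ι-≟ x y with x ℤ.≟ y
    ... | yes ≡.refl = just refl
    ... | no _       = nothing

  open import Algebra.Solver.Ring (CommutativeRing.rawRing ℤP.+-*-commutativeRing) (fromCommutativeRing commutativeRing) ι-morphism ι-≟
    using (solve; _:=_; _:+_; _:*_; _:-_; :-_; con)

  ι-^ : ∀ a n → ι (+ a) ^ n ≈ ι (+ (a ℕ.^ n))
  ι-^ a zero    = sym (+-identityʳ 1#)
  ι-^ a (suc n) = begin
    ι (+ a) * ι (+ a) ^ n           ≈⟨ *-congˡ (ι-^ a n) ⟩
    ι (+ a) * ι (+ (a ℕ.^ n))       ≈⟨ ι-* (+ a) (+ (a ℕ.^ n)) ⟨
    ι (+ a ℤ.* + (a ℕ.^ n))         ≡⟨ ≡.cong ι (ℤP.pos-* a (a ℕ.^ n)) ⟨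
    ι (+ (a ℕ.^ suc n))             ∎

  ∑-cong : ∀ n {f f′ : Fin n → A} → (∀ j → f j ≈ f′ j) → ∑ n f ≈ ∑ n f′
  ∑-cong zero    f≈f′ = refl
  ∑-cong (suc n) f≈f′ = +-cong (f≈f′ Fin.zero) (∑-cong n (f≈f′ ∘ Fin.suc))

  ∑-*ˡ : ∀ n a (f : Fin n → A) → ∑ n (λ j → a * f j) ≈ a * ∑ n f
  ∑-*ˡ zero    a f = sym (zeroʳ a)
  ∑-*ˡ (suc n) a f = trans (+-congˡ (∑-*ˡ n a (f ∘ Fin.suc))) (sym (distribˡ a _ _))

  evalHom-homogeneous : ∀ w cf m x y → evalHom w cf (m ℤ.* x) (m ℤ.* y) ≈ ι m ^ w * evalHom w cf x y
  evalHom-homogeneous w cf m x y =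
    trans (∑-cong (suc w) monomial) (∑-*ˡ (suc w) (ι m ^ w) (λ j → cf j * ι x ^ toℕ j * ι y ^ (w ℕ.∸ toℕ j)))
    where
    monomial : ∀ j → cf j * ι (m ℤ.* x) ^ toℕ j * ι (m ℤ.* y) ^ (w ℕ.∸ toℕ j)
                   ≈ ι m ^ w * (cf j * ι x ^ toℕ j * ι y ^ (w ℕ.∸ toℕ j))
    monomial j = begin
      cf j * ι (m ℤ.* x) ^ i * ι (m ℤ.* y) ^ i′
        ≈⟨ *-cong (*-congˡ (^-congˡ i (ι-* m x))) (^-congˡ i′ (ι-* m y)) ⟩
      cf j * (ι m * ι x) ^ i * (ι m * ι y) ^ i′
        ≈⟨ *-cong (*-congˡ (^-distrib-* _ _ i)) (^-distrib-* _ _ i′) ⟩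
      cf j * (ι m ^ i * ι x ^ i) * (ι m ^ i′ * ι y ^ i′)
        ≈⟨ solve 5 (λ a m₁ x₁ m₂ y₁ → a :* (m₁ :* x₁) :* (m₂ :* y₁) := (m₁ :* m₂) :* (a :* x₁ :* y₁)) refl _ _ _ _ _ ⟩
      (ι m ^ i * ι m ^ i′) * (cf j * ι x ^ i * ι y ^ i′)
        ≈⟨ *-congʳ (^-homo-* (ι m) i i′) ⟨
      ι m ^ (i ℕ.+ i′) * (cf j * ι x ^ i * ι y ^ i′)
        ≡⟨ ≡.cong (λ n → ι m ^ n * (cf j * ι x ^ i * ι y ^ i′)) (ℕP.m+[n∸m]≡n (toℕ≤pred[n] j)) ⟩
      ι m ^ w * (cf j * ι x ^ i * ι y ^ i′)
        ∎
      where i = toℕ j; i′ = w ℕ.∸ toℕ j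

  homogeneous : ∀ {w g} → IsHomPoly w g → ∀ m x y → g (m ℤ.* x) (m ℤ.* y) ≈ ι m ^ w * g x y
  homogeneous {w} (cf , g≈) m x y =
    trans (g≈ _ _) (trans (evalHom-homogeneous w cf m x y) (*-congˡ (sym (g≈ x y))))

  0P-isHomPoly : ∀ w → IsHomPoly w 0P
  0P-isHomPoly w = (λ _ → 0#) , λ h k → sym (zero-form h k)
    where
    zero-form : ∀ h k → evalHom w (λ _ → 0#) h k ≈ 0#
    zero-form h k = begin
      ∑ (suc w) (λ j → 0# * ι h ^ toℕ j * ι k ^ (w ℕ.∸ toℕ j))  ≈⟨ ∑-cong (suc w) (λ j → *-assoc 0# (ι h ^ toℕ j) (ι k ^ (w ℕ.∸ toℕ j))) ⟩
      ∑ (suc w) (λ j → 0# * monomial j)                        ≈⟨ ∑-*ˡ (suc w) 0# monomial ⟩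
      0# * ∑ (suc w) monomial                                  ≈⟨ zeroˡ _ ⟩
      0#                                                       ∎
      where monomial = λ j → ι h ^ toℕ j * ι k ^ (w ℕ.∸ toℕ j)

  ι-*-·ℕ : ∀ n x → ι (+ n) * x ≈ n ·ℕ x
  ι-*-·ℕ n x = trans (×-assoc-* n 1# x) (×-congʳ n (*-identityˡ x))

  ·ℕ-cancel : CharZero → ∀ n {x} → suc n ·ℕ x ≈ 0# → x ≈ 0#
  ·ℕ-cancel charZero n {x} nx≈0 with inverse (ι (+ suc n)) (charZero n)
  ... | y , ny≈1 = begin
    x                        ≈⟨ *-identityˡ x ⟨
    1# * x                   ≈⟨ *-congʳ ny≈1 ⟨
    (ι (+ suc n) * y) * x    ≈⟨ solve 3 (λ n y x → (n :* y) :* x := y :* (n :* x)) refl _ y x ⟩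
    y * (ι (+ suc n) * x)    ≈⟨ *-congˡ (trans (ι-*-·ℕ (suc n) x) nx≈0) ⟩
    y * 0#                   ≈⟨ zeroʳ y ⟩
    0#                       ∎

  -- Polynomial functions on ℤ and ℤ × ℤ

  Δ : (ℤ → A) → ℤ → A
  Δ f x = f (x ℤ.+ 1ℤ) - f x

  DegreeAtMost : ℕ → (ℤ → A) → Set ℓ
  DegreeAtMost zero    f = ∀ x → f x ≈ f 0ℤ
  DegreeAtMost (suc d) f = DegreeAtMost d (Δ f)

  degree-resp : ∀ d {f f′} → (∀ x → f x ≈ f′ x) → DegreeAtMost d f → DegreeAtMost d f′
  degree-resp zero    f≈f′ deg x = trans (sym (f≈f′ x)) (trans (deg x) (f≈f′ 0ℤ))
  degree-resp (suc d) f≈f′ deg = degree-resp d (λ x → +-cong (f≈f′ _) (-‿cong (f≈f′ x))) deg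

  degree-const : ∀ d a → DegreeAtMost d (λ _ → a)
  degree-const zero    a _ = refl
  degree-const (suc d) a   = degree-const d (a - a)

  degree-+ : ∀ d {f g} → DegreeAtMost d f → DegreeAtMost d g → DegreeAtMost d (λ x → f x + g x)
  degree-+ zero    degf degg x = +-cong (degf x) (degg x)
  degree-+ (suc d) degf degg = degree-resp d Δ-+ (degree-+ d degf degg)
    where Δ-+ = λ x → solve 4 (λ a b c d → (a :- c) :+ (b :- d) := (a :+ b) :- (c :+ d)) refl _ _ _ _

  degree-*ˡ : ∀ d a {f} → DegreeAtMost d f → DegreeAtMost d (λ x → a * f x)
  degree-*ˡ zero    a deg x = *-congˡ (deg x)
  degree-*ˡ (suc d) a deg = degree-resp d Δ-*ˡ (degree-*ˡ d a deg)
    where Δ-*ˡ = λ x → solve 3 (λ a b c → a :* (b :- c) := a :* b :- a :* c) refl a _ _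

  degree-neg : ∀ d {f} → DegreeAtMost d f → DegreeAtMost d (λ x → - f x)
  degree-neg d deg = degree-resp d (λ _ → -1*x≈-x _) (degree-*ˡ d (- 1#) deg)

  degree-shift : ∀ d c {f} → DegreeAtMost d f → DegreeAtMost d (λ x → f (x ℤ.+ c))
  degree-shift zero    c     deg x = trans (deg _) (sym (deg _))
  degree-shift (suc d) c {f} deg = degree-resp d (λ x → +-congʳ (reflexive (≡.cong f ([x+c]+1≡[x+1]+c x c)))) (degree-shift d c deg)

  degree-* : ∀ a b {f g} → DegreeAtMost a f → DegreeAtMost b g → DegreeAtMost (a ℕ.+ b) (λ x → f x * g x)
  degree-* zero    b {f} degf degg = degree-resp b (λ x → *-congʳ (sym (degf x))) (degree-*ˡ b (f 0ℤ) degg)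
  degree-* (suc a) zero {f} {g} degf degg =
    ≡.subst (λ n → DegreeAtMost n (λ x → f x * g x)) (≡.sym (ℕP.+-identityʳ (suc a)))
      (degree-resp (suc a) (λ x → trans (*-comm _ _) (*-congˡ (sym (degg x)))) (degree-*ˡ (suc a) (g 0ℤ) degf))
  degree-* (suc a) (suc b) {f} {g} degf degg =
    degree-resp (a ℕ.+ suc b) product-rule (degree-+ (a ℕ.+ suc b) Δf·g degf·Δg)
    where
    product-rule : ∀ x → Δ f x * g (x ℤ.+ 1ℤ) + f x * Δ g x ≈ Δ (λ y → f y * g y) x
    product-rule x = solve 4 (λ f₁ f₀ g₁ g₀ → (f₁ :- f₀) :* g₁ :+ f₀ :* (g₁ :- g₀) := f₁ :* g₁ :- f₀ :* g₀) refl _ _ _ _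
    Δf·g : DegreeAtMost (a ℕ.+ suc b) (λ x → Δ f x * g (x ℤ.+ 1ℤ))
    Δf·g = degree-* a (suc b) degf (degree-shift (suc b) 1ℤ degg)
    degf·Δg : DegreeAtMost (a ℕ.+ suc b) (λ x → f x * Δ g x)
    degf·Δg = ≡.subst (λ n → DegreeAtMost n (λ x → f x * Δ g x)) (≡.sym (ℕP.+-suc a b)) (degree-* (suc a) b degf degg)

  degree-ι-affine : ∀ a b → DegreeAtMost 1 (λ t → ι (a ℤ.* t ℤ.+ b))
  degree-ι-affine a b x = trans (Δ≈a x) (sym (Δ≈a 0ℤ))
    where
    step : ∀ x → a ℤ.* (x ℤ.+ 1ℤ) ℤ.+ b ≡ (a ℤ.* x ℤ.+ b) ℤ.+ a
    step x = ℤSolver.solve (a ∷ b ∷ x ∷ [])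
    Δ≈a : ∀ x → Δ (λ t → ι (a ℤ.* t ℤ.+ b)) x ≈ ι a
    Δ≈a x = begin
      ι (a ℤ.* (x ℤ.+ 1ℤ) ℤ.+ b) - ι (a ℤ.* x ℤ.+ b)     ≡⟨ ≡.cong (λ y → ι y - ι (a ℤ.* x ℤ.+ b)) (step x) ⟩
      ι ((a ℤ.* x ℤ.+ b) ℤ.+ a) - ι (a ℤ.* x ℤ.+ b)     ≈⟨ +-congʳ (ι-+ (a ℤ.* x ℤ.+ b) a) ⟩
      (ι (a ℤ.* x ℤ.+ b) + ι a) - ι (a ℤ.* x ℤ.+ b)     ≈⟨ solve 2 (λ u v → (u :+ v) :- u := v) refl _ _ ⟩
      ι a                                               ∎

  degree-^ : ∀ {f} → DegreeAtMost 1 f → ∀ n → DegreeAtMost n (λ t → f t ^ n)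
  degree-^ deg zero    _ = refl
  degree-^ deg (suc n) = degree-* 1 n deg (degree-^ deg n)

  degree-∑ : ∀ d n (F : Fin n → ℤ → A) → (∀ j → DegreeAtMost d (F j)) → DegreeAtMost d (λ t → ∑ n (λ j → F j t))
  degree-∑ d zero    F deg = degree-const d 0#
  degree-∑ d (suc n) F deg = degree-+ d (deg Fin.zero) (degree-∑ d n (F ∘ Fin.suc) (deg ∘ Fin.suc))

  evalHom-on-line : ∀ w cf a₁ a₀ b₁ b₀ → DegreeAtMost w (λ t → evalHom w cf (a₁ ℤ.* t ℤ.+ a₀) (b₁ ℤ.* t ℤ.+ b₀))
  evalHom-on-line w cf a₁ a₀ b₁ b₀ = degree-∑ w (suc w) term term-degree
    where
    term : Fin (suc w) → ℤ → A
    term j t = cf j * ι (a₁ ℤ.* t ℤ.+ a₀) ^ toℕ j * ι (b₁ ℤ.* t ℤ.+ b₀) ^ (w ℕ.∸ toℕ j)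
    term-degree : ∀ j → DegreeAtMost w (term j)
    term-degree j = ≡.subst (λ n → DegreeAtMost n (term j)) (ℕP.m+[n∸m]≡n (toℕ≤pred[n] j))
      (degree-* (toℕ j) (w ℕ.∸ toℕ j)
        (degree-*ˡ (toℕ j) (cf j) (degree-^ (degree-ι-affine a₁ a₀) (toℕ j)))
        (degree-^ (degree-ι-affine b₁ b₀) (w ℕ.∸ toℕ j)))

  step-invariant⇒constant : ∀ {f : ℤ → A} → (∀ x → f (x ℤ.+ 1ℤ) ≈ f x) → ∀ x → f x ≈ f 0ℤ
  step-invariant⇒constant     inv (+ zero)       = refl
  step-invariant⇒constant {f} inv (+ suc n)      =
    trans (reflexive (≡.cong (f ∘ +_) (ℕP.+-comm 1 n))) (trans (inv (+ n)) (step-invariant⇒constant inv (+ n)))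
  step-invariant⇒constant     inv -[1+ zero ]    = sym (inv -[1+ zero ])
  step-invariant⇒constant     inv -[1+ suc n ]   = trans (sym (inv -[1+ suc n ])) (step-invariant⇒constant inv -[1+ n ])

  degree-vanishing : ∀ d {f} → DegreeAtMost d f → (∀ n → f (+ suc n) ≈ 0#) → ∀ x → f x ≈ 0#
  degree-vanishing zero    deg f≈0 x = trans (deg x) (trans (sym (deg (+ 1))) (f≈0 0))
  degree-vanishing (suc d) {f} deg f≈0 x =
    trans (step-invariant⇒constant inv x) (trans (sym (step-invariant⇒constant inv (+ 1))) (f≈0 0))
    where
    Δf≈0 : ∀ n → Δ f (+ suc n) ≈ 0#
    Δf≈0 n = trans (+-cong (f≈0 (n ℕ.+ 1)) (-‿cong (f≈0 n))) (-‿inverseʳ 0#)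
    inv : ∀ x → f (x ℤ.+ 1ℤ) ≈ f x
    inv x = x∙y⁻¹≈ε⇒x≈y _ _ (degree-vanishing d deg Δf≈0 x)

  periodic⇒constant : CharZero → ∀ d p {f} → DegreeAtMost d f → (∀ x → f (x ℤ.+ + suc p) ≈ f x) → ∀ x → f x ≈ f 0ℤ
  periodic⇒constant charZero zero    p     deg per = deg
  periodic⇒constant charZero (suc d) p {f} deg per = step-invariant⇒constant inv
    where
    Δf-periodic : ∀ x → Δ f (x ℤ.+ + suc p) ≈ Δ f x
    Δf-periodic x = +-cong (trans (reflexive (≡.cong f ([x+c]+1≡[x+1]+c x (+ suc p)))) (per (x ℤ.+ 1ℤ))) (-‿cong (per x))
    e = Δ f 0ℤ
    Δf≈e : ∀ x → Δ f x ≈ e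
    Δf≈e = periodic⇒constant charZero d p deg Δf-periodic
    linear : ∀ x n → f (x ℤ.+ + n) ≈ f x + n ·ℕ e
    linear x zero    = trans (reflexive (≡.cong f (ℤP.+-identityʳ x))) (sym (+-identityʳ _))
    linear x (suc n) = begin
      f (x ℤ.+ + suc n)                 ≡⟨ ≡.cong f (x+[1+n]≡[x+n]+1 x n) ⟩
      f ((x ℤ.+ + n) ℤ.+ 1ℤ)            ≈⟨ solve 2 (λ a b → a := b :+ (a :- b)) refl _ _ ⟩
      f (x ℤ.+ + n) + Δ f (x ℤ.+ + n)   ≈⟨ +-cong (linear x n) (Δf≈e _) ⟩
      (f x + n ·ℕ e) + e                ≈⟨ solve 3 (λ a m e → (a :+ m) :+ e := a :+ (e :+ m)) refl _ _ _ ⟩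
      f x + suc n ·ℕ e                  ∎
    e≈0 : e ≈ 0#
    e≈0 = ·ℕ-cancel charZero p (+-identityʳ-unique _ _ (trans (sym (linear 0ℤ (suc p))) (per 0ℤ)))
    inv : ∀ x → f (x ℤ.+ 1ℤ) ≈ f x
    inv x = x∙y⁻¹≈ε⇒x≈y _ _ (trans (Δf≈e x) e≈0)

  homPoly-on-affine : ∀ {w g a b} → IsHomPoly w g → Affine a → Affine b → DegreeAtMost w (λ t → g (a t) (b t))
  homPoly-on-affine {w} {g} (cf , g≈) (a₁ , a₀ , a≡) (b₁ , b₀ , b≡) =
    degree-resp w (λ t → trans (sym (g≈ _ _)) (reflexive (≡.cong₂ g (≡.sym (a≡ t)) (≡.sym (b≡ t))))) (evalHom-on-line w cf a₁ a₀ b₁ b₀)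

  DegreeAtMost₂ : ℕ → (ℤ → ℤ → A) → Set ℓ
  DegreeAtMost₂ d F = (∀ y → DegreeAtMost d (λ x → F x y)) × (∀ x → DegreeAtMost d (F x))

  homPoly∘affine : ∀ {w g a b} → IsHomPoly w g → Affine₂ a → Affine₂ b → DegreeAtMost₂ w (λ x y → g (a x y) (b x y))
  homPoly∘affine hp (aˣ , aʸ) (bˣ , bʸ) = (λ y → homPoly-on-affine hp (aˣ y) (bˣ y)) , (λ x → homPoly-on-affine hp (aʸ x) (bʸ x))

  degree₂-+ : ∀ d {F G} → DegreeAtMost₂ d F → DegreeAtMost₂ d G → DegreeAtMost₂ d (λ x y → F x y + G x y)
  degree₂-+ d (Fˣ , Fʸ) (Gˣ , Gʸ) = (λ y → degree-+ d (Fˣ y) (Gˣ y)) , (λ x → degree-+ d (Fʸ x) (Gʸ x))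

  degree₂-neg : ∀ d {F} → DegreeAtMost₂ d F → DegreeAtMost₂ d (λ x y → - F x y)
  degree₂-neg d (Fˣ , Fʸ) = (λ y → degree-neg d (Fˣ y)) , (λ x → degree-neg d (Fʸ x))

  degree₂-vanishing : ∀ d {F} → DegreeAtMost₂ d F → (∀ h k → F (+ suc h) (+ suc k) ≈ 0#) → ∀ x y → F x y ≈ 0#
  degree₂-vanishing d (Fˣ , Fʸ) F≈0 x =
    degree-vanishing d (Fʸ x) (λ k → degree-vanishing d (Fˣ (+ suc k)) (λ h → F≈0 h k) x)

  agree-on-positives : ∀ d {F G} → DegreeAtMost₂ d F → DegreeAtMost₂ d G →
                       (∀ h k → F (+ suc h) (+ suc k) ≈ G (+ suc h) (+ suc k)) → ∀ x y → F x y ≈ G x y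
  agree-on-positives d degF degG F≈G x y = x∙y⁻¹≈ε⇒x≈y _ _
    (degree₂-vanishing d (degree₂-+ d degF (degree₂-neg d degG)) (λ h k → x≈y⇒x∙y⁻¹≈ε (F≈G h k)) x y)

  -- The reflection law of 𝓤_w

  ι[-1]^[2m]≈1 : ∀ m → ι -1ℤ ^ (2 ℕ.* m) ≈ 1#
  ι[-1]^[2m]≈1 zero    = refl
  ι[-1]^[2m]≈1 (suc m) = begin
    ι -1ℤ ^ (2 ℕ.* suc m)                   ≡⟨ ≡.cong (ι -1ℤ ^_) (ℕP.*-suc 2 m) ⟩
    ι -1ℤ * (ι -1ℤ * ι -1ℤ ^ (2 ℕ.* m))     ≈⟨ *-congˡ (*-congˡ (ι[-1]^[2m]≈1 m)) ⟩
    ι -1ℤ * (ι -1ℤ * 1#)                    ≈⟨ solve 1 (λ u → con -1ℤ :* (con -1ℤ :* u) := u) refl 1# ⟩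
    1#                                      ∎

  even-weight-symmetric : ∀ {w g} → Σ ℕ (λ m → w ≡ 2 ℕ.* m) → IsHomPoly w g → ∀ x y → g (ℤ.- x) (ℤ.- y) ≈ g x y
  even-weight-symmetric {w} {g} (m , w≡2m) hp x y = begin
    g (ℤ.- x) (ℤ.- y)               ≡⟨ ≡.cong₂ g (ℤP.-1*i≡-i x) (ℤP.-1*i≡-i y) ⟨
    g (-1ℤ ℤ.* x) (-1ℤ ℤ.* y)       ≈⟨ homogeneous hp -1ℤ x y ⟩
    ι -1ℤ ^ w * g x y               ≡⟨ ≡.cong (λ n → ι -1ℤ ^ n * g x y) w≡2m ⟩
    ι -1ℤ ^ (2 ℕ.* m) * g x y       ≈⟨ *-congʳ (ι[-1]^[2m]≈1 m) ⟩
    1# * g x y                      ≈⟨ *-identityˡ _ ⟩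
    g x y                           ∎

  PeriodRelation : (ℤ → ℤ → A) → Set ℓ
  PeriodRelation g = ∀ h k → g (h ℤ.+ k) k + g h (h ℤ.+ k) ≈ g h k

  -- s(x,y) = g(x,-y) + g(y,x) is invariant under both shears (x,y) ↦ (x+y,y) and
  -- (x,y) ↦ (x,x+y). A periodic polynomial is constant, so s(x,k) = s(0,k) = k^w s(0,1),
  -- and s(0,1) = s(1,1) = s(1,2) = s(0,2) = 2^w s(0,1) forces s = 0.
  module _ (charZero : CharZero) {w g} (w-even : Σ ℕ λ m → w ≡ 2 ℕ.* m) (0<w : 0 ℕ.< w)
           (hp : IsHomPoly w g) (period : PeriodRelation g) where

    private
      period-at : ∀ {h k s} → s ≡ h ℤ.+ k → g s k + g h s ≈ g h k
      period-at ≡.refl = period _ _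

      s : ℤ → ℤ → A
      s x y = g x (ℤ.- y) + g y x

      s-degree : DegreeAtMost₂ w s
      s-degree = degree₂-+ w (homPoly∘affine hp affine-x affine--y) (homPoly∘affine hp affine-y affine-x)

      s-homogeneous : ∀ a x y → s (a ℤ.* x) (a ℤ.* y) ≈ ι a ^ w * s x y
      s-homogeneous a x y = begin
        g (a ℤ.* x) (ℤ.- (a ℤ.* y)) + g (a ℤ.* y) (a ℤ.* x)
          ≡⟨ ≡.cong (λ z → g (a ℤ.* x) z + g (a ℤ.* y) (a ℤ.* x)) (ℤP.neg-distribʳ-* a y) ⟩
        g (a ℤ.* x) (a ℤ.* ℤ.- y) + g (a ℤ.* y) (a ℤ.* x)
          ≈⟨ +-cong (homogeneous hp a x (ℤ.- y)) (homogeneous hp a y x) ⟩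
        ι a ^ w * g x (ℤ.- y) + ι a ^ w * g y x
          ≈⟨ distribˡ _ _ _ ⟨
        ι a ^ w * s x y ∎

      split : ∀ h k → g k h ≈ g (h ℤ.+ k) h + g k (h ℤ.+ k)
      split h k = sym (period-at (ℤP.+-comm h k))

      s-shearˡ : ∀ h k → s h k ≈ s (h ℤ.+ k) k
      s-shearˡ h k = begin
        g h (ℤ.- k) + g k h                                   ≈⟨ +-congˡ (split h k) ⟩
        g h (ℤ.- k) + (g (h ℤ.+ k) h + g k (h ℤ.+ k))         ≈⟨ +-assoc _ _ _ ⟨
        (g h (ℤ.- k) + g (h ℤ.+ k) h) + g k (h ℤ.+ k)         ≈⟨ +-congʳ (period-at (≡.sym ([h+k]-k≡h h k))) ⟩
        g (h ℤ.+ k) (ℤ.- k) + g k (h ℤ.+ k)                   ∎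

      s-shearʳ : ∀ h k → s h k ≈ s h (h ℤ.+ k)
      s-shearʳ h k = begin
        g h (ℤ.- k) + g k h                                   ≈⟨ +-congˡ (split h k) ⟩
        g h (ℤ.- k) + (g (h ℤ.+ k) h + g k (h ℤ.+ k))         ≈⟨ solve 3 (λ a b c → a :+ (b :+ c) := (c :+ a) :+ b) refl _ _ _ ⟩
        (g k (h ℤ.+ k) + g h (ℤ.- k)) + g (h ℤ.+ k) h         ≈⟨ +-congʳ (+-cong refl (sym (flip-sign k))) ⟩
        (g k (h ℤ.+ k) + g (ℤ.- h) k) + g (h ℤ.+ k) h         ≈⟨ +-congʳ (period-at (≡.sym (-h+[h+k]≡k h k))) ⟩
        g (ℤ.- h) (h ℤ.+ k) + g (h ℤ.+ k) h                   ≈⟨ +-congʳ (flip-sign (h ℤ.+ k)) ⟩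
        g h (ℤ.- (h ℤ.+ k)) + g (h ℤ.+ k) h                   ∎
        where
        flip-sign : ∀ y → g (ℤ.- h) y ≈ g h (ℤ.- y)
        flip-sign y = trans (reflexive (≡.cong (g (ℤ.- h)) (≡.sym (ℤP.neg-involutive y)))) (even-weight-symmetric w-even hp h (ℤ.- y))

      s-constant-in-x : ∀ p x → s x (+ suc p) ≈ s 0ℤ (+ suc p)
      s-constant-in-x p = periodic⇒constant charZero w p (proj₁ s-degree (+ suc p)) (λ x → sym (s-shearˡ x (+ suc p)))

      s[0,1]≈0 : s 0ℤ 1ℤ ≈ 0#
      s[0,1]≈0 with N , 2^w≡2+N ← 2^n≡2+N 0<w = ·ℕ-cancel charZero N (+-identityʳ-unique _ _ (sym (begin
        s 0ℤ 1ℤ                 ≈⟨ s-constant-in-x 0 1ℤ ⟨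
        s 1ℤ 1ℤ                 ≈⟨ s-shearʳ 1ℤ 1ℤ ⟩
        s 1ℤ (+ 2)              ≈⟨ s-constant-in-x 1 1ℤ ⟩
        s 0ℤ (+ 2)              ≈⟨ s-homogeneous (+ 2) 0ℤ 1ℤ ⟩
        ι (+ 2) ^ w * s 0ℤ 1ℤ   ≈⟨ *-congʳ (ι-^ 2 w) ⟩
        ι (+ (2 ℕ.^ w)) * s 0ℤ 1ℤ ≈⟨ ι-*-·ℕ (2 ℕ.^ w) _ ⟩
        (2 ℕ.^ w) ·ℕ s 0ℤ 1ℤ    ≡⟨ ≡.cong (_·ℕ s 0ℤ 1ℤ) 2^w≡2+N ⟩
        s 0ℤ 1ℤ + suc N ·ℕ s 0ℤ 1ℤ ∎)))

      s≈0 : ∀ x y → s x y ≈ 0#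
      s≈0 = degree₂-vanishing w s-degree λ h k → begin
        s (+ suc h) (+ suc k)          ≈⟨ s-constant-in-x k (+ suc h) ⟩
        s 0ℤ (+ suc k)                 ≡⟨ ≡.cong₂ s (ℤP.*-zeroʳ (+ suc k)) (ℤP.*-identityʳ (+ suc k)) ⟨
        s (+ suc k ℤ.* 0ℤ) (+ suc k ℤ.* 1ℤ)  ≈⟨ s-homogeneous (+ suc k) 0ℤ 1ℤ ⟩
        ι (+ suc k) ^ w * s 0ℤ 1ℤ      ≈⟨ *-congˡ s[0,1]≈0 ⟩
        ι (+ suc k) ^ w * 0#           ≈⟨ zeroʳ _ ⟩
        0#                             ∎

    U-reflection : ∀ h k → g h (ℤ.- k) ≈ - g k h
    U-reflection h k = +-inverseˡ-unique _ _ (s≈0 h k)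

  -- Periodic symbols

  periodic-multiple : ∀ h {f : ℤ → A} → (∀ k → f (k ℤ.+ + h) ≈ f k) → ∀ k N → f (k ℤ.+ + (N ℕ.* h)) ≈ f k
  periodic-multiple h {f} per k zero    = reflexive (≡.cong f (ℤP.+-identityʳ k))
  periodic-multiple h {f} per k (suc N) = begin
    f (k ℤ.+ (+ h ℤ.+ + (N ℕ.* h)))   ≡⟨ ≡.cong f (x+[a+b]≡[x+b]+a k (+ h) (+ (N ℕ.* h))) ⟩
    f ((k ℤ.+ + (N ℕ.* h)) ℤ.+ + h)   ≈⟨ per _ ⟩
    f (k ℤ.+ + (N ℕ.* h))             ≈⟨ periodic-multiple h per k N ⟩
    f k                               ∎

  periodic-residue : ∀ h .{{_ : NonZero h}} {f : ℤ → A} → (∀ k → f (k ℤ.+ + h) ≈ f k) → ∀ k → f k ≈ f (+ (k %ℤ h))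
  periodic-residue h {f} per (+ n) = begin
    f (+ n)                                ≡⟨ ≡.cong (f ∘ +_) (m≡m%n+[m/n]*n n h) ⟩
    f (+ (n % h) ℤ.+ + (n / h ℕ.* h))      ≈⟨ periodic-multiple h per (+ (n % h)) (n / h) ⟩
    f (+ (n % h))                          ∎
  periodic-residue h {f} per -[1+ n ] = begin
    f -[1+ n ]                                   ≈⟨ periodic-multiple h per -[1+ n ] (suc (n / h)) ⟨
    f (-[1+ n ] ℤ.+ + (suc (n / h) ℕ.* h))      ≡⟨ ≡.cong f (-[1+n]+[1+n/h]*h≡+[-[1+n]%ℤh] n h) ⟩
    f (+ (-[1+ n ] %ℤ h))                        ∎

  Periodic : Sym → Set ℓ
  Periodic E = ∀ h k → 0 ℕ.< h → E h (k ℤ.+ + h) ≈ E h k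

  Reciprocal : Sym → Set ℓ
  Reciprocal D = ∀ h k → 0 ℕ.< h → 0 ℕ.< k → D h (+ k) ≈ D k (ℤ.- (+ h))

  -- Run the Euclidean algorithm on (h, k): periodicity replaces k by its
  -- residue r < h, and reciprocity passes from (h, r) to (r, -h).
  euclid-vanishing : ∀ {D} → Periodic D → Reciprocal D → (∀ d → 0 ℕ.< d → D d 0ℤ ≈ 0#) →
                     ∀ h k → 0 ℕ.< h → D h k ≈ 0#
  euclid-vanishing {D} per rec D[d,0]≈0 = <-rec _ step
    where
    step : ∀ h → (∀ {h′} → h′ ℕ.< h → ∀ k → 0 ℕ.< h′ → D h′ k ≈ 0#) → ∀ k → 0 ℕ.< h → D h k ≈ 0#
    step h@(suc _) IH k 0<h = trans (periodic-residue h (λ k → per h k 0<h) k) (residue-vanishes (k %ℤ h) (%ℤ-< k h))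
      where
      residue-vanishes : ∀ r → r ℕ.< h → D h (+ r) ≈ 0#
      residue-vanishes zero    _   = D[d,0]≈0 h 0<h
      residue-vanishes (suc r) r<h = trans (rec h (suc r) 0<h (s≤s z≤n)) (IH r<h (ℤ.- + h) (s≤s z≤n))

  periodic-ext : ∀ {E E′} → Periodic E → Periodic E′ →
                 (∀ h k → 0 ℕ.< h → 0 ℕ.< k → β E h k ≈ β E′ h k) →
                 (∀ d → 0 ℕ.< d → E d 0ℤ ≈ E′ d 0ℤ) → EqSym E E′
  periodic-ext {E} {E′} perE perE′ βE≈βE′ E≈E′-on-axis h k 0<h =
    x∙y⁻¹≈ε⇒x≈y _ _ (euclid-vanishing perD recD (λ d 0<d → x≈y⇒x∙y⁻¹≈ε (E≈E′-on-axis d 0<d)) h k 0<h)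
    where
    D : Sym
    D h k = E h k - E′ h k
    perD : Periodic D
    perD h k 0<h = +-cong (perE h k 0<h) (-‿cong (perE′ h k 0<h))
    recD : Reciprocal D
    recD h k 0<h 0<k = begin
      E h (+ k) - E′ h (+ k)
        ≈⟨ solve 4 (λ a b c d → a :- b := ((a :- c) :- (b :- d)) :+ (c :- d)) refl _ _ _ _ ⟩
      (β E h k - β E′ h k) + (E k (ℤ.- + h) - E′ k (ℤ.- + h))
        ≈⟨ +-congʳ (x≈y⇒x∙y⁻¹≈ε (βE≈βE′ h k 0<h 0<k)) ⟩
      0# + (E k (ℤ.- + h) - E′ k (ℤ.- + h))
        ≈⟨ +-identityˡ _ ⟩
      E k (ℤ.- + h) - E′ k (ℤ.- + h)
        ∎

  β-period-relation : ∀ {E} → Periodic E → ∀ h k → 0 ℕ.< h → 0 ℕ.< k →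
                      β E (h ℕ.+ k) k + β E h (h ℕ.+ k) ≈ β E h k
  β-period-relation {E} per h k 0<h 0<k = begin
    (E (h ℕ.+ k) (+ k) - E k (ℤ.- + (h ℕ.+ k))) + (E h (+ (h ℕ.+ k)) - E (h ℕ.+ k) (ℤ.- + h))
      ≈⟨ +-cong (+-cong E[h+k,k]≈X (-‿cong E[k,-h-k]≈Y)) (+-congʳ E[h,h+k]≈Z) ⟩
    (X - Y) + (Z - X)
      ≈⟨ solve 3 (λ x y z → (x :- y) :+ (z :- x) := z :- y) refl X Y Z ⟩
    Z - Y
      ∎
    where
    0<h+k = ℕP.<-≤-trans 0<h (ℕP.m≤m+n h k)
    X = E (h ℕ.+ k) (ℤ.- + h)
    Y = E k (ℤ.- + h)
    Z = E h (+ k)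
    E[h+k,k]≈X : E (h ℕ.+ k) (+ k) ≈ X
    E[h+k,k]≈X = trans (reflexive (≡.cong (E (h ℕ.+ k)) (≡.sym (-h+[h+k]≡k (+ h) (+ k))))) (per (h ℕ.+ k) (ℤ.- + h) 0<h+k)
    E[k,-h-k]≈Y : E k (ℤ.- + (h ℕ.+ k)) ≈ Y
    E[k,-h-k]≈Y = trans (sym (per k _ 0<k)) (reflexive (≡.cong (E k) (-[h+k]+k≡-h (+ h) (+ k))))
    E[h,h+k]≈Z : E h (+ (h ℕ.+ k)) ≈ Z
    E[h,h+k]≈Z = trans (reflexive (≡.cong (E h ∘ +_) (ℕP.+-comm h k))) (per h (+ k) 0<h)

  β-diagonal : ∀ {E} → Periodic E → ∀ h → 0 ℕ.< h → β E h h ≈ 0#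
  β-diagonal {E} per h 0<h = x≈y⇒x∙y⁻¹≈ε (begin
    E h (+ h)                    ≈⟨ per h 0ℤ 0<h ⟩
    E h 0ℤ                       ≡⟨ ≡.cong (E h) (ℤP.+-inverseˡ (+ h)) ⟨
    E h (ℤ.- + h ℤ.+ + h)        ≈⟨ per h (ℤ.- + h) 0<h ⟩
    E h (ℤ.- + h)                ∎)

  β-into-U : ∀ w E → InE w E → Σ (ℤ → ℤ → A) λ g → InU w g × Represents E g
  β-into-U w E ((per , _) , g , hp , rep) = g , (hp , period , g[1,1]≈0) , rep
    where
    period-on-positives : ∀ h k → g (+ suc h ℤ.+ + suc k) (+ suc k) + g (+ suc h) (+ suc h ℤ.+ + suc k) ≈ g (+ suc h) (+ suc k)
    period-on-positives h k = begin
      g (+ (suc h ℕ.+ suc k)) (+ suc k) + g (+ suc h) (+ (suc h ℕ.+ suc k))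
        ≈⟨ +-cong (rep _ _ (s≤s z≤n) (s≤s z≤n)) (rep _ _ (s≤s z≤n) (s≤s z≤n)) ⟨
      β E (suc h ℕ.+ suc k) (suc k) + β E (suc h) (suc h ℕ.+ suc k)
        ≈⟨ β-period-relation per (suc h) (suc k) (s≤s z≤n) (s≤s z≤n) ⟩
      β E (suc h) (suc k)
        ≈⟨ rep _ _ (s≤s z≤n) (s≤s z≤n) ⟩
      g (+ suc h) (+ suc k)
        ∎
    period : PeriodRelation g
    period = agree-on-positives w
      (degree₂-+ w (homPoly∘affine hp affine-x+y affine-y) (homPoly∘affine hp affine-x affine-x+y))
      (homPoly∘affine hp affine-x affine-y) period-on-positives
    g[1,1]≈0 : g 1ℤ 1ℤ ≈ 0#
    g[1,1]≈0 = trans (sym (rep 1 1 (s≤s z≤n) (s≤s z≤n))) (β-diagonal per 1 (s≤s z≤n))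

  infixr 8 _◃_
  _◃_ : Sign → A → A
  Sign.+ ◃ x = x
  Sign.- ◃ x = - x

  ◃-cong : ∀ s {x y} → x ≈ y → s ◃ x ≈ s ◃ y
  ◃-cong Sign.+ x≈y = x≈y
  ◃-cong Sign.- x≈y = -‿cong x≈y

  ◃-involutive : ∀ s x → s ◃ s ◃ x ≈ x
  ◃-involutive Sign.+ x = refl
  ◃-involutive Sign.- x = -‿involutive x

  ◃-neg : ∀ s x → s ◃ (- x) ≈ - (s ◃ x)
  ◃-neg Sign.+ x = refl
  ◃-neg Sign.- x = refl

  ◃-+ : ∀ s x y → s ◃ (x + y) ≈ s ◃ x + s ◃ y
  ◃-+ Sign.+ x y = refl
  ◃-+ Sign.- x y = sym (-‿+-comm x y)

  ◃-*ʳ : ∀ s a x → s ◃ (a * x) ≈ a * (s ◃ x)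
  ◃-*ʳ Sign.+ a x = refl
  ◃-*ʳ Sign.- a x = -‿distribʳ-* a x

  degree₂-◃ : ∀ d s {F} → DegreeAtMost₂ d F → DegreeAtMost₂ d (λ x y → s ◃ F x y)
  degree₂-◃ d Sign.+ deg = deg
  degree₂-◃ d Sign.- deg = degree₂-neg d deg

  -- SymParity Sign.+ and SymParity Sign.- are EvenE and OddE by definition; likewise for PolyParity.
  SymParity : Sign → Sym → Set ℓ
  SymParity s E = ∀ h k → 0 ℕ.< h → E h (ℤ.- k) ≈ s ◃ E h k

  PolyParity : Sign → (ℤ → ℤ → A) → Set ℓ
  PolyParity s g = ∀ h k → g h (ℤ.- k) ≈ s ◃ g h k

  β-parity : ∀ s {E} → SymParity s E → ∀ h k → 0 ℕ.< h → 0 ℕ.< k → β E k h ≈ - (s ◃ β E h k)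
  β-parity s {E} parity h k 0<h 0<k = begin
    E k (+ h) - E h (ℤ.- + k)                  ≈⟨ +-congˡ (-‿cong (parity h (+ k) 0<h)) ⟩
    E k (+ h) - s ◃ E h (+ k)                  ≈⟨ flip-sign s _ _ ⟩
    - (s ◃ (E h (+ k) - s ◃ E k (+ h)))         ≈⟨ -‿cong (◃-cong s (+-congˡ (-‿cong (parity k (+ h) 0<k)))) ⟨
    - (s ◃ (E h (+ k) - E k (ℤ.- + h)))         ∎
    where
    flip-sign : ∀ s a b → b - s ◃ a ≈ - (s ◃ (a - s ◃ b))
    flip-sign Sign.+ a b = solve 2 (λ a b → b :- a := :- (a :- b)) refl a b
    flip-sign Sign.- a b = solve 2 (λ a b → b :- :- a := :- :- (a :- :- b)) refl a b

  represented-parity : CharZero → ∀ {w} → Σ ℕ (λ m → w ≡ 2 ℕ.* m) → 0 ℕ.< w → ∀ s {E g} →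
                       SymParity s E → InU w g → Represents E g → PolyParity s g
  represented-parity charZero {w} w-even 0<w s {E} {g} parity (hp , period , _) rep h k = begin
    g h (ℤ.- k)            ≈⟨ U-reflection charZero w-even 0<w hp period h k ⟩
    - g k h                ≈⟨ -‿cong (swap h k) ⟩
    - - (s ◃ g h k)        ≈⟨ -‿involutive _ ⟩
    s ◃ g h k              ∎
    where
    swap : ∀ x y → g y x ≈ - (s ◃ g x y)
    swap = agree-on-positives w (homPoly∘affine hp affine-y affine-x)
      (degree₂-neg w (degree₂-◃ w s (homPoly∘affine hp affine-x affine-y))) λ x y → begin
        g (+ suc y) (+ suc x)              ≈⟨ rep _ _ (s≤s z≤n) (s≤s z≤n) ⟨
        β E (suc y) (suc x)                ≈⟨ β-parity s parity (suc x) (suc y) (s≤s z≤n) (s≤s z≤n) ⟩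
        - (s ◃ β E (suc x) (suc y))        ≈⟨ -‿cong (◃-cong s (rep _ _ (s≤s z≤n) (s≤s z≤n))) ⟩
        - (s ◃ g (+ suc x) (+ suc y))      ∎

  module _ (charZero : CharZero) where

    ½ : A
    ½ = proj₁ (inverse (ι (+ 2)) (charZero 1))

    ½-double : ∀ x → ½ * (x + x) ≈ x
    ½-double x = begin
      ½ * (x + x)           ≈⟨ *-congˡ (solve 1 (λ x → x :+ x := con (+ 2) :* x) refl x) ⟩
      ½ * (ι (+ 2) * x)     ≈⟨ solve 3 (λ i t x → i :* (t :* x) := (t :* i) :* x) refl ½ (ι (+ 2)) x ⟩
      (ι (+ 2) * ½) * x     ≈⟨ *-congʳ (proj₂ (inverse (ι (+ 2)) (charZero 1))) ⟩
      1# * x                ≈⟨ *-identityˡ x ⟩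
      x                     ∎

    x≈-x⇒x≈0 : ∀ {x} → x ≈ - x → x ≈ 0#
    x≈-x⇒x≈0 {x} x≈-x = begin
      x              ≈⟨ ½-double x ⟨
      ½ * (x + x)    ≈⟨ *-congˡ (+-congˡ x≈-x) ⟩
      ½ * (x - x)    ≈⟨ *-congˡ (-‿inverseʳ x) ⟩
      ½ * 0#         ≈⟨ zeroʳ ½ ⟩
      0#             ∎

    parityPart : Sign → Sym → Sym
    parityPart s E h k = ½ * (E h k + s ◃ E h (ℤ.- k))

    parityPart-isWDS : ∀ s {w E} → IsWDS w E → IsWDS w (parityPart s E)
    parityPart-isWDS s {w} {E} (per , hom) = perP , homP
      where
      perP : Periodic (parityPart s E)
      perP h k 0<h = *-congˡ (+-cong (per h k 0<h) (◃-cong s (begin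
        E h (ℤ.- (k ℤ.+ + h))             ≈⟨ per h _ 0<h ⟨
        E h (ℤ.- (k ℤ.+ + h) ℤ.+ + h)     ≡⟨ ≡.cong (E h) (-[h+k]+k≡-h k (+ h)) ⟩
        E h (ℤ.- k)                       ∎)))
      homP : ∀ m h k → 0 ℕ.< m → 0 ℕ.< h → parityPart s E (m ℕ.* h) (+ m ℤ.* k) ≈ ι (+ m) ^ w * parityPart s E h k
      homP m h k 0<m 0<h = begin
        ½ * (E (m ℕ.* h) (+ m ℤ.* k) + s ◃ E (m ℕ.* h) (ℤ.- (+ m ℤ.* k)))
          ≡⟨ ≡.cong (λ z → ½ * (E (m ℕ.* h) (+ m ℤ.* k) + s ◃ E (m ℕ.* h) z)) (ℤP.neg-distribʳ-* (+ m) k) ⟩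
        ½ * (E (m ℕ.* h) (+ m ℤ.* k) + s ◃ E (m ℕ.* h) (+ m ℤ.* ℤ.- k))
          ≈⟨ *-congˡ (+-cong (hom m h k 0<m 0<h) (◃-cong s (hom m h (ℤ.- k) 0<m 0<h))) ⟩
        ½ * (M * E h k + s ◃ (M * E h (ℤ.- k)))
          ≈⟨ *-congˡ (+-congˡ (◃-*ʳ s M _)) ⟩
        ½ * (M * E h k + M * s ◃ E h (ℤ.- k))
          ≈⟨ solve 4 (λ i M a b → i :* (M :* a :+ M :* b) := M :* (i :* (a :+ b))) refl ½ M _ _ ⟩
        M * (½ * (E h k + s ◃ E h (ℤ.- k)))
          ∎
        where M = ι (+ m) ^ w

    parityPart-parity : ∀ s E → SymParity s (parityPart s E)
    parityPart-parity s E h k _ = begin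
      ½ * (E h (ℤ.- k) + s ◃ E h (ℤ.- ℤ.- k))           ≡⟨ ≡.cong (λ z → ½ * (E h (ℤ.- k) + s ◃ E h z)) (ℤP.neg-involutive k) ⟩
      ½ * (E h (ℤ.- k) + s ◃ E h k)                     ≈⟨ *-congˡ (+-comm _ _) ⟩
      ½ * (s ◃ E h k + E h (ℤ.- k))                     ≈⟨ *-congˡ (+-congˡ (◃-involutive s _)) ⟨
      ½ * (s ◃ E h k + s ◃ s ◃ E h (ℤ.- k))             ≈⟨ *-congˡ (◃-+ s _ _) ⟨
      ½ * s ◃ (E h k + s ◃ E h (ℤ.- k))                 ≈⟨ ◃-*ʳ s ½ _ ⟨
      s ◃ (½ * (E h k + s ◃ E h (ℤ.- k)))               ∎

    parityPart-represents : ∀ s {E g} → (∀ h k → g h (ℤ.- k) ≈ - g k h) → PolyParity s g →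
                            Represents E g → Represents (parityPart s E) g
    parityPart-represents s {E} {g} reflection parity rep h k 0<h 0<k = begin
      ½ * (E h (+ k) + s ◃ E h (ℤ.- + k)) - ½ * (E k (ℤ.- + h) + s ◃ E k (ℤ.- ℤ.- + h))
        ≡⟨ ≡.cong (λ z → ½ * (E h (+ k) + s ◃ E h (ℤ.- + k)) - ½ * (E k (ℤ.- + h) + s ◃ E k z)) (ℤP.neg-involutive (+ h)) ⟩
      ½ * (E h (+ k) + s ◃ E h (ℤ.- + k)) - ½ * (E k (ℤ.- + h) + s ◃ E k (+ h))
        ≈⟨ solve 5 (λ i a b c d → i :* (a :+ b) :- i :* (c :+ d) := i :* ((a :- c) :+ (b :- d))) refl ½ _ _ _ _ ⟩
      ½ * (β E h k + (s ◃ E h (ℤ.- + k) - s ◃ E k (+ h)))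
        ≈⟨ *-congˡ (+-congˡ (trans (+-congˡ (sym (◃-neg s _))) (sym (◃-+ s _ _)))) ⟩
      ½ * (β E h k + s ◃ (E h (ℤ.- + k) - E k (+ h)))
        ≈⟨ *-congˡ (+-congˡ (◃-cong s (solve 2 (λ a b → a :- b := :- (b :- a)) refl _ _))) ⟩
      ½ * (β E h k + s ◃ (- β E k h))
        ≈⟨ *-congˡ (+-cong (rep h k 0<h 0<k) (◃-cong s (-‿cong (rep k h 0<k 0<h)))) ⟩
      ½ * (g (+ h) (+ k) + s ◃ (- g (+ k) (+ h)))
        ≈⟨ *-congˡ (+-congˡ (◃-cong s (trans (sym (reflection (+ h) (+ k))) (parity (+ h) (+ k))))) ⟩
      ½ * (g (+ h) (+ k) + s ◃ s ◃ g (+ h) (+ k))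
        ≈⟨ *-congˡ (+-congˡ (◃-involutive s _)) ⟩
      ½ * (g (+ h) (+ k) + g (+ h) (+ k))
        ≈⟨ ½-double _ ⟩
      g (+ h) (+ k)
        ∎

  -- Preimages under β

  period-diagonal : ∀ {g} → PeriodRelation g → ∀ h → g h h ≈ 0#
  period-diagonal {g} period h = +-identityʳ-unique _ _ (begin
    g h 0ℤ + g h h                          ≡⟨ ≡.cong (λ x → g x 0ℤ + g h x) (ℤP.+-identityʳ h) ⟨
    g (h ℤ.+ 0ℤ) 0ℤ + g h (h ℤ.+ 0ℤ)        ≈⟨ period h 0ℤ ⟩
    g h 0ℤ                                  ∎)

  -- The symbol with β = g, computed by the Euclidean algorithm: E(h, k) = 0 if
  -- h ∣ k, and otherwise E(h, k) = g(h, r) + E(r, -h) where r = k mod h.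
  module Euclid (g : ℤ → ℤ → A) where

    -- euclid n computes E(h, k) for h ≤ n; n is fuel for the recursion.
    euclid : ℕ → ℕ → ℤ → A
    euclid-step : ℕ → ℕ → ℕ → A
    euclid zero    _       _ = 0#
    euclid (suc n) zero    _ = 0#
    euclid (suc n) (suc h) k = euclid-step n (suc h) (k %ℤ suc h)
    euclid-step n h zero    = 0#
    euclid-step n h (suc r) = g (+ h) (+ suc r) + euclid n (suc r) (ℤ.- + h)

    euclid-fuel : ∀ {n n′ h} k → suc h ℕ.≤ n → suc h ℕ.≤ n′ → euclid n (suc h) k ≡ euclid n′ (suc h) k
    euclid-step-fuel : ∀ {n n′ h} r → r ℕ.< h → h ℕ.≤ suc n → h ℕ.≤ suc n′ → euclid-step n h r ≡ euclid-step n′ h r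
    euclid-fuel {suc n} {suc n′} {h} k h<n h<n′ = euclid-step-fuel (k %ℤ suc h) (%ℤ-< k (suc h)) h<n h<n′
    euclid-step-fuel zero    _   _     _      = ≡.refl
    euclid-step-fuel {h = h} (suc r) r<h h≤1+n h≤1+n′ =
      ≡.cong (λ x → g (+ h) (+ suc r) + x) (euclid-fuel (ℤ.- + h) (ℕP.≤-pred (ℕP.≤-trans r<h h≤1+n)) (ℕP.≤-pred (ℕP.≤-trans r<h h≤1+n′)))

    E : Sym
    E h = euclid h h

    E-axis : ∀ h → E h 0ℤ ≡ 0#
    E-axis zero    = ≡.refl
    E-axis (suc h) = ≡.refl

    E-periodic : Periodic E
    E-periodic (suc h) k _ = reflexive (≡.cong (euclid-step h (suc h)) (%ℤ-periodic k (suc h)))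

    E-below : ∀ h k → 0 ℕ.< k → k ℕ.< h → E h (+ k) ≈ g (+ h) (+ k) + E k (ℤ.- + h)
    E-below (suc h) (suc k) _ k<h = reflexive (≡.trans
      (≡.cong (euclid-step h (suc h)) (m<n⇒m%n≡m k<h))
      (≡.cong (λ x → g (+ suc h) (+ suc k) + x) (euclid-fuel (ℤ.- + suc h) (ℕP.≤-pred k<h) ℕP.≤-refl)))

    module _ (period : PeriodRelation g) where

      E-represents-below : ∀ h k → 0 ℕ.< k → k ℕ.< h → β E h k ≈ g (+ h) (+ k)
      E-represents-below h k 0<k k<h = begin
        E h (+ k) - E k (ℤ.- + h)                               ≈⟨ +-congʳ (E-below h k 0<k k<h) ⟩
        (g (+ h) (+ k) + E k (ℤ.- + h)) - E k (ℤ.- + h)          ≈⟨ solve 2 (λ a b → (a :+ b) :- b := a) refl _ _ ⟩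
        g (+ h) (+ k)                                           ∎

      E-represents-shift : ∀ h j → 0 ℕ.< h → 0 ℕ.< j → β E h j ≈ g (+ h) (+ j) → β E h (h ℕ.+ j) ≈ g (+ h) (+ (h ℕ.+ j))
      E-represents-shift h j 0<h 0<j βE≈g = begin
        β E h (h ℕ.+ j)                                       ≈⟨ solve 2 (λ a b → b := (a :+ b) :- a) refl _ _ ⟩
        (β E (h ℕ.+ j) j + β E h (h ℕ.+ j)) - β E (h ℕ.+ j) j  ≈⟨ +-cong (β-period-relation E-periodic h j 0<h 0<j) (-‿cong below) ⟩
        β E h j - g (+ (h ℕ.+ j)) (+ j)                       ≈⟨ +-congʳ βE≈g ⟩
        g (+ h) (+ j) - g (+ (h ℕ.+ j)) (+ j)                 ≈⟨ +-congʳ (period (+ h) (+ j)) ⟨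
        (g (+ (h ℕ.+ j)) (+ j) + g (+ h) (+ (h ℕ.+ j))) - g (+ (h ℕ.+ j)) (+ j)
                                                              ≈⟨ solve 2 (λ a b → (a :+ b) :- a := b) refl _ _ ⟩
        g (+ h) (+ (h ℕ.+ j))                                 ∎
        where below = E-represents-below (h ℕ.+ j) j 0<j (ℕP.m<n+m j 0<h)

      E-represents : Represents E g
      E-represents h k 0<h 0<k = <-rec P step k h 0<h 0<k
        where
        P : ℕ → Set ℓ
        P k = ∀ h → 0 ℕ.< h → 0 ℕ.< k → β E h k ≈ g (+ h) (+ k)
        step : ∀ k → (∀ {j} → j ℕ.< k → P j) → P k
        step k IH h 0<h 0<k with ℕP.<-cmp k h
        ... | tri< k<h _ _ = E-represents-below h k 0<k k<h
        ... | tri≈ _ ≡.refl _ = trans (β-diagonal E-periodic k 0<k) (sym (period-diagonal period (+ k)))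
        ... | tri> _ _ h<k with o , 1+h+o≡k ← ℕP.m≤n⇒∃[o]m+o≡n h<k =
          ≡.subst (λ k → β E h k ≈ g (+ h) (+ k)) h+j≡k
            (E-represents-shift h (suc o) 0<h (s≤s z≤n) (IH j<k h 0<h (s≤s z≤n)))
          where
          h+j≡k : h ℕ.+ suc o ≡ k
          h+j≡k = ≡.trans (ℕP.+-suc h o) 1+h+o≡k
          j<k : suc o ℕ.< k
          j<k = ≡.subst (suc o ℕ.<_) h+j≡k (ℕP.m<n+m (suc o) 0<h)

      E-homogeneous : ∀ {w} → IsHomPoly w g → ∀ (m h : ℕ) k → 0 ℕ.< m → 0 ℕ.< h →
                      E (m ℕ.* h) (+ m ℤ.* k) ≈ ι (+ m) ^ w * E h k
      E-homogeneous {w} hp m@(suc _) h k _ 0<h = periodic-ext per₁ per₂ β-agree on-axis h k 0<h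
        where
        M = ι (+ m) ^ w
        E₁ E₂ : Sym
        E₁ h k = E (m ℕ.* h) (+ m ℤ.* k)
        E₂ = M • E
        per₁ : Periodic E₁
        per₁ h@(suc _) k _ = begin
          E (m ℕ.* h) (+ m ℤ.* (k ℤ.+ + h))               ≡⟨ ≡.cong (E (m ℕ.* h)) (ℤP.*-distribˡ-+ (+ m) k (+ h)) ⟩
          E (m ℕ.* h) (+ m ℤ.* k ℤ.+ + m ℤ.* + h)         ≡⟨ ≡.cong (λ x → E (m ℕ.* h) (+ m ℤ.* k ℤ.+ x)) (ℤP.pos-* m h) ⟨
          E (m ℕ.* h) (+ m ℤ.* k ℤ.+ + (m ℕ.* h))         ≈⟨ E-periodic (m ℕ.* h) (+ m ℤ.* k) (s≤s z≤n) ⟩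
          E (m ℕ.* h) (+ m ℤ.* k)                         ∎
        per₂ : Periodic E₂
        per₂ h k 0<h = *-congˡ (E-periodic h k 0<h)
        β-agree : ∀ h k → 0 ℕ.< h → 0 ℕ.< k → β E₁ h k ≈ β E₂ h k
        β-agree h@(suc _) k@(suc _) 0<h 0<k = begin
          E (m ℕ.* h) (+ m ℤ.* + k) - E (m ℕ.* k) (+ m ℤ.* ℤ.- + h)
            ≡⟨ ≡.cong₂ (λ x y → E (m ℕ.* h) x - E (m ℕ.* k) y) (ℤP.pos-* m k)
                 (≡.trans (ℤP.neg-distribʳ-* (+ m) (+ h)) (≡.cong ℤ.-_ (ℤP.pos-* m h))) ⟨
          β E (m ℕ.* h) (m ℕ.* k)                 ≈⟨ E-represents (m ℕ.* h) (m ℕ.* k) (s≤s z≤n) (s≤s z≤n) ⟩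
          g (+ (m ℕ.* h)) (+ (m ℕ.* k))           ≡⟨ ≡.cong₂ g (ℤP.pos-* m h) (ℤP.pos-* m k) ⟩
          g (+ m ℤ.* + h) (+ m ℤ.* + k)           ≈⟨ homogeneous hp (+ m) (+ h) (+ k) ⟩
          M * g (+ h) (+ k)                       ≈⟨ *-congˡ (E-represents h k 0<h 0<k) ⟨
          M * β E h k                             ≈⟨ x[y-z]≈xy-xz M _ _ ⟩
          β E₂ h k                                ∎
        on-axis : ∀ d → 0 ℕ.< d → E₁ d 0ℤ ≈ E₂ d 0ℤ
        on-axis d _ = begin
          E (m ℕ.* d) (+ m ℤ.* 0ℤ)   ≡⟨ ≡.cong (E (m ℕ.* d)) (ℤP.*-zeroʳ (+ m)) ⟩
          E (m ℕ.* d) 0ℤ             ≡⟨ E-axis (m ℕ.* d) ⟩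
          0#                         ≈⟨ zeroʳ M ⟨
          M * 0#                     ≡⟨ ≡.cong (M *_) (E-axis d) ⟨
          M * E d 0ℤ                 ∎

      E-inE : ∀ {w} → IsHomPoly w g → InE w E
      E-inE hp = (E-periodic , E-homogeneous hp) , g , hp , E-represents

  β-surjective : ∀ w g → InU w g → Σ Sym λ E → InE w E × Represents E g
  β-surjective w g (hp , period , _) = E , E-inE period hp , E-represents period
    where open Euclid g

  parity-surjective : CharZero → ∀ {w} → Σ ℕ (λ m → w ≡ 2 ℕ.* m) → 0 ℕ.< w → ∀ s g → InU w g → PolyParity s g →
                      Σ Sym λ E → InE w E × SymParity s E × Represents E g
  parity-surjective charZero {w} w-even 0<w s g (hp , period , _) parity =
    parityPart charZero s E , (parityPart-isWDS charZero s {w} (E-periodic , E-homogeneous period hp) , g , hp , rep) ,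
    parityPart-parity charZero s E , rep
    where
    open Euclid g
    rep : Represents (parityPart charZero s E) g
    rep = parityPart-represents charZero s {E} (U-reflection charZero w-even 0<w hp period) parity (E-represents period)

  -- The kernel of β

  β-cong : ∀ {E E′} → EqSym E E′ → ∀ h k → 0 ℕ.< h → 0 ℕ.< k → β E h k ≈ β E′ h k
  β-cong E≈E′ h k 0<h 0<k = +-cong (E≈E′ h (+ k) 0<h) (-‿cong (E≈E′ k (ℤ.- + h) 0<k))

  β-• : ∀ a E h k → β (a • E) h k ≈ a * β E h k
  β-• a E h k = sym (x[y-z]≈xy-xz a _ _)

  G-periodic : ∀ w → Periodic (G w)
  G-periodic w h k _ = reflexive (≡.cong (λ n → ι (+ n) ^ w) (gcd[n,∣k+n∣]≡gcd[n,∣k∣] h k))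

  G-even : ∀ w → EvenE (G w)
  G-even w h k _ = reflexive (≡.cong (λ n → ι (+ gcd h n) ^ w) (ℤP.∣-i∣≡∣i∣ k))

  G-axis : ∀ w d → G w d 0ℤ ≡ ι (+ d) ^ w
  G-axis w d = ≡.cong (λ n → ι (+ n) ^ w) (gcd-identityʳ d)

  β-G : ∀ w h k → β (G w) h k ≈ 0#
  β-G w h k = x≈y⇒x∙y⁻¹≈ε (reflexive (≡.cong (λ n → ι (+ n) ^ w) (≡.trans (gcd-comm h k) (≡.cong (gcd k) (≡.sym (ℤP.∣-i∣≡∣i∣ (+ h)))))))

  G-homogeneous : ∀ w m h k → G w (m ℕ.* h) (+ m ℤ.* k) ≈ ι (+ m) ^ w * G w h k
  G-homogeneous w m h k = begin
    ι (+ gcd (m ℕ.* h) ∣ + m ℤ.* k ∣) ^ w     ≡⟨ ≡.cong (λ n → ι (+ gcd (m ℕ.* h) n) ^ w) (ℤP.abs-* (+ m) k) ⟩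
    ι (+ gcd (m ℕ.* h) (m ℕ.* ∣ k ∣)) ^ w     ≡⟨ ≡.cong (λ n → ι (+ n) ^ w) (c*gcd[m,n]≡gcd[cm,cn] m h ∣ k ∣) ⟨
    ι (+ (m ℕ.* gcd h ∣ k ∣)) ^ w             ≡⟨ ≡.cong (λ n → ι n ^ w) (ℤP.pos-* m _) ⟩
    ι (+ m ℤ.* + gcd h ∣ k ∣) ^ w             ≈⟨ ^-congˡ w (ι-* (+ m) _) ⟩
    (ι (+ m) * ι (+ gcd h ∣ k ∣)) ^ w         ≈⟨ ^-distrib-* _ _ w ⟩
    ι (+ m) ^ w * G w h k                     ∎

  G-inE : ∀ w → InE w (G w)
  G-inE w = (G-periodic w , λ m h k _ _ → G-homogeneous w m h k) , 0P , 0P-isHomPoly w , λ h k _ _ → β-G w h k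

  kernel-⊆-span : ∀ {w E} → InE w E → Represents E 0P → EqSym E (E 1 0ℤ • G w)
  kernel-⊆-span {w} {E} ((per , hom) , _) rep = periodic-ext per (λ h k 0<h → *-congˡ (G-periodic w h k 0<h)) β-agree on-axis
    where
    a = E 1 0ℤ
    β-agree : ∀ h k → 0 ℕ.< h → 0 ℕ.< k → β E h k ≈ β (a • G w) h k
    β-agree h k 0<h 0<k = begin
      β E h k           ≈⟨ rep h k 0<h 0<k ⟩
      0#                ≈⟨ zeroʳ a ⟨
      a * 0#            ≈⟨ *-congˡ (β-G w h k) ⟨
      a * β (G w) h k   ≈⟨ β-• a (G w) h k ⟨
      β (a • G w) h k   ∎
    on-axis : ∀ d → 0 ℕ.< d → E d 0ℤ ≈ a * G w d 0ℤ
    on-axis d 0<d = begin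
      E d 0ℤ                     ≡⟨ ≡.cong₂ E (ℕP.*-identityʳ d) (ℤP.*-zeroʳ (+ d)) ⟨
      E (d ℕ.* 1) (+ d ℤ.* 0ℤ)   ≈⟨ hom d 1 0ℤ 0<d (s≤s z≤n) ⟩
      ι (+ d) ^ w * a            ≈⟨ *-comm _ a ⟩
      a * ι (+ d) ^ w            ≡⟨ ≡.cong (a *_) (G-axis w d) ⟨
      a * G w d 0ℤ               ∎

  span-⊆-kernel : ∀ {w E} → Σ A (λ a → EqSym E (a • G w)) → Represents E 0P
  span-⊆-kernel {w} {E} (a , E≈aG) h k 0<h 0<k = begin
    β E h k            ≈⟨ β-cong E≈aG h k 0<h 0<k ⟩
    β (a • G w) h k    ≈⟨ β-• a (G w) h k ⟩
    a * β (G w) h k    ≈⟨ *-congˡ (β-G w h k) ⟩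
    a * 0#             ≈⟨ zeroʳ a ⟩
    0#                 ∎

  kernel-is-span : ∀ w E → InE w E →
                   (Represents E 0P → Σ A λ a → EqSym E (a • G w)) × (Σ A (λ a → EqSym E (a • G w)) → Represents E 0P)
  kernel-is-span w E E∈𝓔 = (λ rep → E 1 0ℤ , kernel-⊆-span E∈𝓔 rep) , span-⊆-kernel {w}

  odd-injective : CharZero → ∀ {w} E E′ g → InE w E → OddE E → InE w E′ → OddE E′ →
                  Represents E g → Represents E′ g → EqSym E E′
  odd-injective charZero _ _ _ ((per , _) , _) odd ((per′ , _) , _) odd′ rep rep′ =
    periodic-ext per per′ (λ h k 0<h 0<k → trans (rep h k 0<h 0<k) (sym (rep′ h k 0<h 0<k)))
      (λ d 0<d → trans (x≈-x⇒x≈0 charZero (odd d 0ℤ 0<d)) (sym (x≈-x⇒x≈0 charZero (odd′ d 0ℤ 0<d))))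

open import Data.Nat using (_≤_; _*_)

theorem1p2 : {c ℓ : Level} (K : Field c ℓ) → Theory.CharZero K →
  (w : ℕ) → Σ ℕ (λ m → w ≡ 2 * m) → 2 ≤ w →
  let open Theory K
      open Field K using (Carrier)
  in
  -- β_w maps 𝓔_w into 𝓤_w
  (∀ E → InE w E → Σ (ℤ → ℤ → Carrier) λ g → InU w g × Represents E g) ×
  -- β_w is onto 𝓤_w
  (∀ g → InU w g → Σ Sym λ E → InE w E × Represents E g) ×
  -- β_w(𝓔_w^+) = 𝓤_w^+
  ((∀ E g → InE w E → EvenE E → InU w g → Represents E g → EvenU g) ×
   (∀ g → InU w g → EvenU g → Σ Sym λ E → InE w E × EvenE E × Represents E g)) ×
  -- β_w(𝓔_w^-) = 𝓤_w^-
  ((∀ E g → InE w E → OddE E → InU w g → Represents E g → OddU g) ×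
   (∀ g → InU w g → OddU g → Σ Sym λ E → InE w E × OddE E × Represents E g)) ×
  -- ker β_w = span(G_w) inside 𝓔_w
  (InE w (G w) ×
   (∀ E → InE w E →
      (Represents E 0P → Σ Carrier λ a → EqSym E (a • G w)) ×
      (Σ Carrier (λ a → EqSym E (a • G w)) → Represents E 0P))) ×
  -- β_w^- : 𝓔_w^- → 𝓤_w^- is injective (hence, with the above, an isomorphism)
  (∀ E E' g → InE w E → OddE E → InE w E' → OddE E' →
     Represents E g → Represents E' g → EqSym E E') ×
  -- β_w^+ : kernel is span(G_w) inside 𝓔_w^+
  (EvenE (G w) ×
   (∀ E → InE w E → EvenE E →
      (Represents E 0P → Σ Carrier λ a → EqSym E (a • G w)) ×
      (Σ Carrier (λ a → EqSym E (a • G w)) → Represents E 0P)))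
theorem1p2 K charZero w w-even 2≤w =
  β-into-U K w ,
  β-surjective K w ,
  ((λ E g _ → represented-parity K charZero w-even 0<w Sign.+) , parity-surjective K charZero w-even 0<w Sign.+) ,
  ((λ E g _ → represented-parity K charZero w-even 0<w Sign.-) , parity-surjective K charZero w-even 0<w Sign.-) ,
  (G-inE K w , kernel-is-span K w) ,
  odd-injective K charZero ,
  (G-even K w , λ E E∈𝓔 _ → kernel-is-span K w E E∈𝓔)
  where
  0<w : 0 ℕ.< w
  0<w = ℕP.<-≤-trans (s≤s z≤n) 2≤w
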